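{- Let $X$ be a graph. If $X$ is class I, then its complete generalized truncation is class I. If $X$ is class II and its maximum valency is even, then its complete generalized truncation is class I.
   Context: Generalized truncation of a graph $X$ (without isolated vertices): take a matching $M_0$ with $|M_0|=|E(X)|$ (on $2|E(X)|$ new vertices) and a bijection $F:E(X)\to M_0$; for each edge $e$ of $X$ with ends $u,v$, label one end of $F(e)$ by $u$ and the other by $v$. For $v\in V(X)$, the cluster $\mathrm{cl}(v)$ is the set of vertices labelled $v$; insert a graph $\mathrm{con}(v)$ (constituent) on $\mathrm{cl}(v)$. The result is a generalized truncation; it is the complete generalized truncation if every constituent is a complete graph. A graph is class I if its chromatic index (minimum number of colors in a proper edge coloring) equals its maximum valency, and class II otherwise. -}

module Defs where

open import Data.Bool using (Bool; true; false; T; _∧_; _∨_; not)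
open import Data.Nat using (ℕ; _≤_)
open import Data.Fin using (Fin)
open import Data.Product using (Σ; Σ-syntax; _×_; _,_; proj₁; proj₂)
open import Data.Sum using (_⊎_)
open import Data.Empty using (⊥)
open import Relation.Nullary using (¬_; yes; no)
open import Relation.Nullary.Decidable using (⌊_⌋)
open import Relation.Binary.Definitions using (DecidableEquality)
open import Relation.Binary.PropositionalEquality using (_≡_; _≢_; refl; sym; cong)
open import Function.Bundles using (_↔_)

record Graph : Set₁ where
  field
    V      : Set
    _≟_    : DecidableEquality V
    adj    : V → V → Bool
    adj-sym    : ∀ u v → adj u v ≡ adj v u
    adj-irrefl : ∀ v → adj v v ≡ false

open Graph public

Adj : (G : Graph) → V G → V G → Set
Adj G u v = T (adj G u v)

Finite : Graph → Set
Finite G = Σ ℕ λ n → V G ↔ Fin n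

NoIsolatedVertices : Graph → Set
NoIsolatedVertices G = ∀ v → Σ (V G) λ w → Adj G v w

N : (G : Graph) → V G → Set
N G v = Σ (V G) λ w → Adj G v w

Valency : (G : Graph) → V G → ℕ → Set
Valency G v d = N G v ↔ Fin d

MaxValency : Graph → ℕ → Set
MaxValency G Δ =
  (∀ v d → Valency G v d → d ≤ Δ) ×
  ((Σ (V G) λ v → Valency G v Δ) ⊎ (¬ V G × Δ ≡ 0))

record EdgeColouring (G : Graph) (k : ℕ) : Set where
  field
    colour : (u v : V G) → Adj G u v → Fin k
    colour-sym : ∀ u v (p : Adj G u v) (q : Adj G v u) → colour u v p ≡ colour v u q
    proper : ∀ u v w (p : Adj G u v) (q : Adj G u w) → v ≢ w → colour u v p ≢ colour u w q

ChromaticIndex : Graph → ℕ → Set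
ChromaticIndex G k = EdgeColouring G k × (∀ j → EdgeColouring G j → k ≤ j)

ClassI : Graph → Set
ClassI G = Σ ℕ λ Δ → MaxValency G Δ × ChromaticIndex G Δ

ClassII : Graph → Set
ClassII G = ¬ ClassI G

-- The vertex ((u , v) , p) with p : Adj u v is the end labelled u of the
-- matching edge F(uv); so cl(u) = { ((u , v) , p) }.
-- Edges: matching edges ((u,v),_) ~ ((v,u),_), and complete constituents:
-- ((u,v),_) ~ ((u,w),_) for v ≢ w.

private
  ⌊⌋-sym : ∀ {A : Set} (_≟_ : DecidableEquality A) x y → ⌊ x ≟ y ⌋ ≡ ⌊ y ≟ x ⌋
  ⌊⌋-sym _≟_ x y with x ≟ y | y ≟ x
  ... | yes _ | yes _ = refl
  ... | no _  | no _  = refl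
  ... | yes e | no n  with n (sym e)
  ... | ()
  ⌊⌋-sym _≟_ x y | no n | yes e with n (sym e)
  ... | ()

  ∧-comm : ∀ a b → a ∧ b ≡ b ∧ a
  ∧-comm true true = refl
  ∧-comm true false = refl
  ∧-comm false true = refl
  ∧-comm false false = refl

  ⌊⌋-refl : ∀ {A : Set} (_≟_ : DecidableEquality A) x → ⌊ x ≟ x ⌋ ≡ true
  ⌊⌋-refl _≟_ x with x ≟ x
  ... | yes _ = refl
  ... | no n with n refl
  ... | ()

  T-irr : ∀ b (x y : T b) → x ≡ y
  T-irr true _ _ = refl

  ∧-false : ∀ a → a ∧ false ≡ false
  ∧-false true = refl
  ∧-false false = refl

module _ (X : Graph) where
  private
    _≟X_ = _≟_ X

  TV : Set
  TV = Σ (V X × V X) λ e → Adj X (proj₁ e) (proj₂ e)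

  tadj : TV → TV → Bool
  tadj ((u , v) , _) ((u' , v') , _) =
    (⌊ u ≟X v' ⌋ ∧ ⌊ v ≟X u' ⌋) ∨ (⌊ u ≟X u' ⌋ ∧ not ⌊ v ≟X v' ⌋)

  private
    nolo : ∀ u v → Adj X u v → ⌊ u ≟X v ⌋ ≡ false
    nolo u v p with u ≟X v
    nolo u .u p | yes refl with adj X u u | adj-irrefl X u
    nolo u .u () | yes refl | .false | refl
    nolo u v p | no _ = refl

    _≟T_ : DecidableEquality TV
    ((u , v) , p) ≟T ((u' , v') , p') with u ≟X u' | v ≟X v'
    ... | no n | _ = no λ { refl → n refl }
    ... | yes _ | no n = no λ { refl → n refl }
    ((u , v) , p) ≟T ((.u , .v) , p') | yes refl | yes refl = yes (cong ((u , v) ,_) (T-irr (adj X u v) p p'))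

    tsym : ∀ a b → tadj a b ≡ tadj b a
    tsym ((u , v) , _) ((u' , v') , _)
      rewrite ⌊⌋-sym _≟X_ u v' | ⌊⌋-sym _≟X_ v u' | ∧-comm ⌊ v' ≟X u ⌋ ⌊ u' ≟X v ⌋
            | ⌊⌋-sym _≟X_ u u' | ⌊⌋-sym _≟X_ v v' = refl

    tirr : ∀ a → tadj a a ≡ false
    tirr ((u , v) , p) rewrite nolo u v p | ⌊⌋-refl _≟X_ u | ⌊⌋-refl _≟X_ v = refl

  CompleteGeneralizedTruncation : Graph
  CompleteGeneralizedTruncation = record
    { V = TV ; _≟_ = _≟T_ ; adj = tadj ; adj-sym = tsym ; adj-irrefl = tirr }

-- The vertex (u , v) of the complete truncation is adjacent to (v , u) and to the (u , w) with
-- w ≠ v, so it has the valency of u: the truncation has the same maximum valency Δ as X, and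
-- it suffices to colour its edges with Δ colours. Given a Δ-edge-colouring c of X, colour the
-- matching edge of uv with 2 c(uv) and the constituent edge (u , v)(u , w) with c(uv) + c(uw),
-- modulo Δ. If instead Δ = n + 1 with n odd, label the neighbours of each vertex injectively
-- by ∞, 0, …, n - 1, give all matching edges one colour, and colour every constituent by the
-- 1-factorisation of K_{n+1} that gives {a , b} the colour a + b and {∞ , a} the colour 2 a
-- modulo n; doubling is injective modulo the odd number n. This second construction works
-- for every X, class II or not.
module Submission where

open import Defs
open import Data.Bool using (Bool; true; false; T; _∧_; _∨_; not)
open import Data.Bool.Properties using (T-irrelevant; T-∧; T-∨)
open import Data.Empty using (⊥-elim)
open import Data.Fin using (Fin; zero; suc; toℕ)
open import Data.Fin.Properties
  using (toℕ-injective; toℕ-fromℕ<; toℕ<n; 0↔⊥; 1↔⊤; +↔⊎; injective⇒≤; inject≤-injective)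
import Data.Fin.Properties as Fin
open import Data.Nat using (ℕ; zero; suc; _+_; _*_; _∸_; _≤_; _<_; z≤n; NonZero)
open import Data.Nat.Divisibility using (_∣_; divides)
open import Data.Nat.DivMod
open import Data.Nat.Properties using (+-comm; +-assoc; m+[n∸m]≡n; <⇒≤)
open import Data.Nat.Tactic.RingSolver using (solve-∀)
open import Data.Product using (Σ; ∃; _×_; _,_; proj₁)
open import Data.Product.Function.Dependent.Propositional using (Σ-↔)
open import Data.Product.Function.NonDependent.Propositional using (_×-⇔_)
open import Data.Sum using (_⊎_; inj₁; inj₂)
open import Data.Sum.Function.Propositional using (_⊎-↔_; _⊎-⇔_)
open import Function using (_∘_)
open import Function.Bundles using (_↔_; _↣_; _⇔_; Inverse; Injection; Equivalence; mk↔ₛ′; mk↣; mk⇔)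
open import Function.Properties.Equivalence using () renaming (trans to ⇔-trans)
open import Function.Properties.Injection using (↣-trans)
open import Function.Properties.Inverse using (↔-refl; ↔-sym; ↔-trans; ↔⇒↣)
open import Relation.Nullary using (¬_; Dec; yes; no)
open import Relation.Nullary.Decidable
  using (⌊_⌋; True; False; toWitness; fromWitness; toWitnessFalse; fromWitnessFalse)
open import Relation.Binary.PropositionalEquality
open ≡-Reasoning

[m%n+o]%n≡[m+o]%n : ∀ m o n .{{_ : NonZero n}} → (m % n + o) % n ≡ (m + o) % n
[m%n+o]%n≡[m+o]%n m o n = begin
  (m % n + o) % n         ≡⟨ %-distribˡ-+ (m % n) o n ⟩
  (m % n % n + o % n) % n ≡⟨ cong (λ x → (x + o % n) % n) (m%n%n≡m%n m n) ⟩
  (m % n + o % n) % n     ≡⟨ %-distribˡ-+ m o n ⟨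
  (m + o) % n             ∎

[m*[o%n]]%n≡[m*o]%n : ∀ m o n .{{_ : NonZero n}} → (m * (o % n)) % n ≡ (m * o) % n
[m*[o%n]]%n≡[m*o]%n m o n = begin
  (m * (o % n)) % n         ≡⟨ %-distribˡ-* m (o % n) n ⟩
  (m % n * (o % n % n)) % n ≡⟨ cong (λ x → (m % n * x) % n) (m%n%n≡m%n o n) ⟩
  (m % n * (o % n)) % n     ≡⟨ %-distribˡ-* m o n ⟨
  (m * o) % n               ∎

+-%-cancelˡ : ∀ {m o p n} .{{_ : NonZero n}} → m ≤ n → o < n → p < n →
              (m + o) % n ≡ (m + p) % n → o ≡ p
+-%-cancelˡ {m} {o} {p} {n} m≤n o<n p<n eq = begin
  o                               ≡⟨ subtract o<n ⟨
  ((m + o) % n + (n ∸ m)) % n     ≡⟨ cong (λ x → (x + (n ∸ m)) % n) eq ⟩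
  ((m + p) % n + (n ∸ m)) % n     ≡⟨ subtract p<n ⟩
  p                               ∎
  where
  subtract : ∀ {x} → x < n → ((m + x) % n + (n ∸ m)) % n ≡ x
  subtract {x} x<n = begin
    ((m + x) % n + (n ∸ m)) % n ≡⟨ [m%n+o]%n≡[m+o]%n (m + x) (n ∸ m) n ⟩
    (m + x + (n ∸ m)) % n       ≡⟨ cong (_% n) (cong (_+ (n ∸ m)) (+-comm m x)) ⟩
    (x + m + (n ∸ m)) % n       ≡⟨ cong (_% n) (+-assoc x m (n ∸ m)) ⟩
    (x + (m + (n ∸ m))) % n     ≡⟨ cong (λ y → (x + y) % n) (m+[n∸m]≡n m≤n) ⟩
    (x + n) % n                 ≡⟨ [m+n]%n≡m%n x n ⟩
    x % n                       ≡⟨ m<n⇒m%n≡m x<n ⟩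
    x                           ∎

halving-identity : ∀ m x → suc m * (x + x) ≡ x + x * suc (m * 2)
halving-identity = solve-∀

-- suc m is the inverse of 2 modulo the odd number n.
double-%-injective : ∀ m {o p} → let n = suc (m * 2) in
                     o < n → p < n → (o + o) % n ≡ (p + p) % n → o ≡ p
double-%-injective m {o} {p} o<n p<n eq = begin
  o                           ≡⟨ halve o<n ⟨
  (suc m * ((o + o) % n)) % n ≡⟨ cong (λ x → (suc m * x) % n) eq ⟩
  (suc m * ((p + p) % n)) % n ≡⟨ halve p<n ⟩
  p                           ∎
  where
  n = suc (m * 2)
  halve : ∀ {x} → x < n → (suc m * ((x + x) % n)) % n ≡ x
  halve {x} x<n = begin
    (suc m * ((x + x) % n)) % n ≡⟨ [m*[o%n]]%n≡[m*o]%n (suc m) (x + x) n ⟩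
    (suc m * (x + x)) % n       ≡⟨ cong (_% n) (halving-identity m x) ⟩
    (x + x * n) % n             ≡⟨ [m+kn]%n≡m%n x x n ⟩
    x % n                       ≡⟨ m<n⇒m%n≡m x<n ⟩
    x                           ∎

infixl 6 _⊕_
_⊕_ : ∀ {n} → Fin n → Fin n → Fin n
_⊕_ {suc n} a b = (toℕ a + toℕ b) mod suc n

⊕≡⊕⇒%≡% : ∀ {n} (a b c d : Fin (suc n)) → a ⊕ b ≡ c ⊕ d →
                (toℕ a + toℕ b) % suc n ≡ (toℕ c + toℕ d) % suc n
⊕≡⊕⇒%≡% a b c d eq = begin
  (toℕ a + toℕ b) % _ ≡⟨ toℕ-fromℕ< _ ⟨
  toℕ (a ⊕ b)         ≡⟨ cong toℕ eq ⟩
  toℕ (c ⊕ d)         ≡⟨ toℕ-fromℕ< _ ⟩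
  (toℕ c + toℕ d) % _ ∎

⊕-comm : ∀ {n} (a b : Fin n) → a ⊕ b ≡ b ⊕ a
⊕-comm {suc n} a b = cong (_mod suc n) (+-comm (toℕ a) (toℕ b))

⊕-cancelˡ : ∀ {n} (a : Fin n) {b c} → a ⊕ b ≡ a ⊕ c → b ≡ c
⊕-cancelˡ {suc n} a {b} {c} eq =
  toℕ-injective (+-%-cancelˡ (<⇒≤ (toℕ<n a)) (toℕ<n b) (toℕ<n c) (⊕≡⊕⇒%≡% a b a c eq))

⊕-double-injective : ∀ m {a b : Fin (suc (m * 2))} → a ⊕ a ≡ b ⊕ b → a ≡ b
⊕-double-injective m {a} {b} eq =
  toℕ-injective (double-%-injective m (toℕ<n a) (toℕ<n b) (⊕≡⊕⇒%≡% a a b b eq))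

-- zero plays the vertex ∞, and colours are shifted by one so that the colour zero stays free.
oneFactorisation : ∀ {n} → Fin (suc n) → Fin (suc n) → Fin (suc n)
oneFactorisation zero    zero    = zero
oneFactorisation zero    (suc b) = suc (b ⊕ b)
oneFactorisation (suc a) zero    = suc (a ⊕ a)
oneFactorisation (suc a) (suc b) = suc (a ⊕ b)

oneFactorisation-sym : ∀ {n} (a b : Fin (suc n)) → oneFactorisation a b ≡ oneFactorisation b a
oneFactorisation-sym zero    zero    = refl
oneFactorisation-sym zero    (suc b) = refl
oneFactorisation-sym (suc a) zero    = refl
oneFactorisation-sym (suc a) (suc b) = cong suc (⊕-comm a b)

oneFactorisation≢zero : ∀ {n} {a b : Fin (suc n)} → a ≢ b → oneFactorisation a b ≢ zero
oneFactorisation≢zero {a = zero}  {zero}  a≢b _ = a≢b refl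
oneFactorisation≢zero {a = zero}  {suc b} _ ()
oneFactorisation≢zero {a = suc a} {zero}  _ ()
oneFactorisation≢zero {a = suc a} {suc b} _ ()

oneFactorisation-injective : ∀ m {a b c : Fin (suc (suc (m * 2)))} → a ≢ b → a ≢ c →
                             oneFactorisation a b ≡ oneFactorisation a c → b ≡ c
oneFactorisation-injective m {zero}  {zero}  {_}     a≢b _   _  = ⊥-elim (a≢b refl)
oneFactorisation-injective m {zero}  {_}     {zero}  _   a≢c _  = ⊥-elim (a≢c refl)
oneFactorisation-injective m {zero}  {suc b} {suc c} _   _   eq = cong suc (⊕-double-injective m (Fin.suc-injective eq))
oneFactorisation-injective m {suc a} {zero}  {zero}  _   _   _  = refl
oneFactorisation-injective m {suc a} {zero}  {suc c} _   a≢c eq = ⊥-elim (a≢c (cong suc (⊕-cancelˡ a (Fin.suc-injective eq))))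
oneFactorisation-injective m {suc a} {suc b} {zero}  a≢b _   eq = ⊥-elim (a≢b (cong suc (sym (⊕-cancelˡ a (Fin.suc-injective eq)))))
oneFactorisation-injective m {suc a} {suc b} {suc c} _   _   eq = cong suc (⊕-cancelˡ a (Fin.suc-injective eq))

ΣT-≡ : ∀ {A : Set} {P : A → Bool} {a b : A} {x : T (P a)} {y : T (P b)} →
       a ≡ b → _≡_ {A = Σ A (T ∘ P)} (a , x) (b , y)
ΣT-≡ refl = cong (_ ,_) (T-irrelevant _ _)

Σ-Fin-suc↔ : ∀ {m} (P : Fin (suc m) → Set) → Σ (Fin (suc m)) P ↔ (P zero ⊎ Σ (Fin m) (P ∘ suc))
Σ-Fin-suc↔ P = mk↔ₛ′ split join split-join join-split
  where
  split : Σ (Fin _) P → P zero ⊎ Σ (Fin _) (P ∘ suc)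
  split (zero , x) = inj₁ x
  split (suc i , x) = inj₂ (i , x)
  join : P zero ⊎ Σ (Fin _) (P ∘ suc) → Σ (Fin _) P
  join (inj₁ x) = zero , x
  join (inj₂ (i , x)) = suc i , x
  split-join : ∀ y → split (join y) ≡ y
  split-join (inj₁ _) = refl
  split-join (inj₂ _) = refl
  join-split : ∀ x → join (split x) ≡ x
  join-split (zero , _) = refl
  join-split (suc _ , _) = refl

T↔Fin : ∀ b → ∃ λ d → T b ↔ Fin d
T↔Fin true = 1 , ↔-sym 1↔⊤
T↔Fin false = 0 , ↔-sym 0↔⊥

Fin-subset-size : ∀ m (P : Fin m → Bool) → ∃ λ d → Σ (Fin m) (T ∘ P) ↔ Fin d
Fin-subset-size zero P = 0 , mk↔ₛ′ (λ ()) (λ ()) (λ ()) (λ ())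
Fin-subset-size (suc m) P =
  let (c , T↔c) = T↔Fin (P zero)
      (d , rest↔d) = Fin-subset-size m (P ∘ suc)
  in c + d , ↔-trans (Σ-Fin-suc↔ (T ∘ P)) (↔-trans (T↔c ⊎-↔ rest↔d) (↔-sym +↔⊎))

finite-subset-size : ∀ {A : Set} {m} → A ↔ Fin m → (P : A → Bool) → ∃ λ d → Σ A (T ∘ P) ↔ Fin d
finite-subset-size {m = m} A↔m P =
  let (d , e) = Fin-subset-size m (P ∘ Inverse.from A↔m)
  in d , ↔-trans (↔-sym (Σ-↔ (↔-sym A↔m) ↔-refl)) e

valency-exists : ∀ {G} → Finite G → ∀ v → ∃ (Valency G v)
valency-exists {G} (_ , V↔n) v = finite-subset-size V↔n (adj G v)

module _ {G : Graph} where
  open EdgeColouring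

  colour-injective : ∀ {k} (C : EdgeColouring G k) {u v w} (p : Adj G u v) (q : Adj G u w) →
                     colour C u v p ≡ colour C u w q → v ≡ w
  colour-injective C {u} {v} {w} p q eq with _≟_ G v w
  ... | yes v≡w = v≡w
  ... | no v≢w = ⊥-elim (proper C u v w p q v≢w eq)

  maxValency≤colours : ∀ {Δ k} → MaxValency G Δ → EdgeColouring G k → Δ ≤ k
  maxValency≤colours (_ , inj₂ (_ , refl)) C = z≤n
  maxValency≤colours {k = k} (_ , inj₁ (v , N↔Δ)) C =
    injective⇒≤ (Injection.injective (↣-trans (↔⇒↣ (↔-sym N↔Δ)) coloursAt))
    where
    coloursAt : N G v ↣ Fin k
    coloursAt = mk↣ λ {(w , p)} {(w' , p')} eq → ΣT-≡ (colour-injective C p p' eq)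

  classI : ∀ {Δ} → MaxValency G Δ → EdgeColouring G Δ → ClassI G
  classI mv C = _ , mv , C , λ _ → maxValency≤colours mv

  neighbourLabelling : ∀ {Δ} → Finite G → MaxValency G Δ → ∀ v → N G v ↣ Fin Δ
  neighbourLabelling fin (bounded , _) v =
    let (d , N↔d) = valency-exists {G} fin v
        d≤Δ = bounded v d N↔d
    in ↣-trans (↔⇒↣ N↔d) (mk↣ λ {i} {j} → inject≤-injective d≤Δ d≤Δ i j)

  maxValency0⇒noVertices : NoIsolatedVertices G → MaxValency G 0 → ¬ V G
  maxValency0⇒noVertices noIsolated (_ , inj₁ (v , N↔0)) _ with Inverse.to N↔0 (noIsolated v)
  ... | ()
  maxValency0⇒noVertices _ (_ , inj₂ (noVertices , _)) = noVertices

  noVertices-colouring : ∀ {k} → ¬ V G → EdgeColouring G k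
  noVertices-colouring noVertices = record
    { colour = λ u _ _ → ⊥-elim (noVertices u)
    ; colour-sym = λ u _ _ _ → ⊥-elim (noVertices u)
    ; proper = λ u _ _ _ _ _ → ⊥-elim (noVertices u)
    }

True⇔ : ∀ {A : Set} (a? : Dec A) → True a? ⇔ A
True⇔ a? = mk⇔ toWitness fromWitness

False⇔ : ∀ {A : Set} (a? : Dec A) → False a? ⇔ (¬ A)
False⇔ a? = mk⇔ toWitnessFalse fromWitnessFalse

T-∧∨∧¬⇔ : ∀ {A B C D : Set} (a? : Dec A) (b? : Dec B) (c? : Dec C) (d? : Dec D) →
          T ((⌊ a? ⌋ ∧ ⌊ b? ⌋) ∨ (⌊ c? ⌋ ∧ not ⌊ d? ⌋)) ⇔ ((A × B) ⊎ (C × ¬ D))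
T-∧∨∧¬⇔ a? b? c? d? =
  ⇔-trans T-∨ (⇔-trans T-∧ (True⇔ a? ×-⇔ True⇔ b?) ⊎-⇔ ⇔-trans T-∧ (True⇔ c? ×-⇔ False⇔ d?))

module _ (X : Graph) where

  TX : Graph
  TX = CompleteGeneralizedTruncation X

  Arc : Set
  Arc = V TX

  private
    _≟X_ = _≟_ X

  adj-irreflexive : ∀ {u} → ¬ Adj X u u
  adj-irreflexive {u} p = subst T (adj-irrefl X u) p

  adj-symmetric : ∀ {u v} → Adj X u v → Adj X v u
  adj-symmetric {u} {v} = subst T (adj-sym X u v)

  data Link (u v : V X) : V X → V X → Set where
    clique   : ∀ {w} → v ≢ w → Link u v u w
    matching : Link u v v u

  link⇔ : ∀ {u v u' v'} (p : Adj X u v) (p' : Adj X u' v') →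
          Adj TX ((u , v) , p) ((u' , v') , p') ⇔ ((u ≡ v' × v ≡ u') ⊎ (u ≡ u' × v ≢ v'))
  link⇔ {u} {v} {u'} {v'} _ _ = T-∧∨∧¬⇔ (u ≟X v') (v ≟X u') (u ≟X u') (v ≟X v')

  link : ∀ {u v u' v'} (p : Adj X u v) (p' : Adj X u' v') → Adj TX ((u , v) , p) ((u' , v') , p') → Link u v u' v'
  link p p' e with Equivalence.to (link⇔ p p') e
  ... | inj₁ (refl , refl) = matching
  ... | inj₂ (refl , v≢v') = clique v≢v'

  linked : ∀ {u v u' v'} (p : Adj X u v) (p' : Adj X u' v') → Link u v u' v' → Adj TX ((u , v) , p) ((u' , v') , p')
  linked p p' (clique v≢w) = Equivalence.from (link⇔ p p') (inj₂ (refl , v≢w))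
  linked p p' matching = Equivalence.from (link⇔ p p') (inj₁ (refl , refl))

  arc-≡ : ∀ {u v u' v'} {p : Adj X u v} {p' : Adj X u' v'} → u ≡ u' → v ≡ v' →
          _≡_ {A = Arc} ((u , v) , p) ((u' , v') , p')
  arc-≡ {u} {v} refl refl = cong ((u , v) ,_) (T-irrelevant _ _)

  arcNeighbours↔ : ∀ {u v} (p : Adj X u v) → N TX ((u , v) , p) ↔ N X u
  arcNeighbours↔ {u} {v} p = mk↔ₛ′ endpoint arcTo endpoint-arcTo arcTo-endpoint
    where
    endpoint : N TX ((u , v) , p) → N X u
    endpoint (((u' , v') , p') , e) with link p p' e
    ... | clique _ = v' , p'
    ... | matching = v , p

    arcTo : N X u → N TX ((u , v) , p)
    arcTo (w , q) with w ≟X v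
    ... | yes refl = ((v , u) , adj-symmetric p) , linked p (adj-symmetric p) matching
    ... | no w≢v = ((u , w) , q) , linked p q (clique λ v≡w → w≢v (sym v≡w))

    endpoint-arcTo : ∀ x → endpoint (arcTo x) ≡ x
    endpoint-arcTo (w , q) with w ≟X v
    ... | yes refl with link p (adj-symmetric p) (linked p (adj-symmetric p) matching)
    ...   | clique _ = ⊥-elim (adj-irreflexive p)
    ...   | matching = ΣT-≡ refl
    endpoint-arcTo (w , q) | no w≢v with link p q (linked p q (clique λ v≡w → w≢v (sym v≡w)))
    ...   | clique _ = refl
    ...   | matching = ⊥-elim (adj-irreflexive p)

    arcTo-endpoint : ∀ x → arcTo (endpoint x) ≡ x
    arcTo-endpoint (((u' , v') , p') , e) with link p p' e
    ... | clique {w} v≢w with w ≟X v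
    ...   | yes refl = ⊥-elim (v≢w refl)
    ...   | no _ = ΣT-≡ refl
    arcTo-endpoint (((u' , v') , p') , e) | matching = ΣT-≡ (trans (arcTo-back p) (arc-≡ refl refl))
      where
      arcTo-back : ∀ q → proj₁ (arcTo (v , q)) ≡ ((v , u) , adj-symmetric p)
      arcTo-back q with v ≟X v
      ... | yes refl = refl
      ... | no v≢v = ⊥-elim (v≢v refl)

  truncation-maxValency : ∀ {Δ} → NoIsolatedVertices X → MaxValency X Δ → MaxValency TX Δ
  truncation-maxValency {Δ} noIsolated (bounded , attained) = bounded′ , attained′ attained
    where
    bounded′ : ∀ a d → Valency TX a d → d ≤ Δ
    bounded′ ((u , v) , p) d N↔d = bounded u d (↔-trans (↔-sym (arcNeighbours↔ p)) N↔d)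
    attained′ : (Σ (V X) λ u → Valency X u Δ) ⊎ (¬ V X × Δ ≡ 0) →
                (Σ Arc λ a → Valency TX a Δ) ⊎ (¬ Arc × Δ ≡ 0)
    attained′ (inj₁ (u , N↔Δ)) =
      let (w , q) = noIsolated u in inj₁ (((u , w) , q) , ↔-trans (arcNeighbours↔ q) N↔Δ)
    attained′ (inj₂ (noVertices , Δ≡0)) = inj₂ ((λ a → noVertices (proj₁ (proj₁ a))) , Δ≡0)

  record ConstituentColouring (k : ℕ) : Set where
    field
      matchingColour : ∀ u v → Adj X u v → Fin k
      matchingColour-sym : ∀ u v p q → matchingColour u v p ≡ matchingColour v u q
      cliqueColour : ∀ u v w → Adj X u v → Adj X u w → Fin k
      cliqueColour-sym : ∀ u v w p q → cliqueColour u v w p q ≡ cliqueColour u w v q p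
      cliqueColour-injective : ∀ u v w w' p q q' → v ≢ w → v ≢ w' →
                               cliqueColour u v w p q ≡ cliqueColour u v w' p q' → w ≡ w'
      cliqueColour≢matchingColour : ∀ u v w p q → v ≢ w → cliqueColour u v w p q ≢ matchingColour u v p

  truncationColouring : ∀ {k} → ConstituentColouring k → EdgeColouring TX k
  truncationColouring {k} C = record
    { colour = λ { ((_ , _) , p) ((_ , _) , p') e → linkColour p p' (link p p' e) }
    ; colour-sym = λ { ((_ , _) , p) ((_ , _) , p') e e' → linkColour-sym p p' (link p p' e) (link p' p e') }
    ; proper = λ { ((_ , _) , p) ((_ , _) , p₁) ((_ , _) , p₂) e₁ e₂ →
                   linkColour-proper p p₁ p₂ (link p p₁ e₁) (link p p₂ e₂) }
    }
    where
    open ConstituentColouring C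

    linkColour : ∀ {u v u' v'} (p : Adj X u v) (p' : Adj X u' v') → Link u v u' v' → Fin k
    linkColour p p' (clique _) = cliqueColour _ _ _ p p'
    linkColour p p' matching = matchingColour _ _ p

    linkColour-sym : ∀ {u v u' v'} (p : Adj X u v) (p' : Adj X u' v') (l : Link u v u' v') (l' : Link u' v' u v) →
                     linkColour p p' l ≡ linkColour p' p l'
    linkColour-sym p p' (clique _) (clique _) = cliqueColour-sym _ _ _ p p'
    linkColour-sym p p' (clique _) matching = ⊥-elim (adj-irreflexive p)
    linkColour-sym p p' matching (clique _) = ⊥-elim (adj-irreflexive p)
    linkColour-sym p p' matching matching = matchingColour-sym _ _ p p'

    linkColour-proper : ∀ {u v u₁ v₁ u₂ v₂} (p : Adj X u v) (p₁ : Adj X u₁ v₁) (p₂ : Adj X u₂ v₂) →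
                        (l₁ : Link u v u₁ v₁) (l₂ : Link u v u₂ v₂) →
                        _≢_ {A = Arc} ((u₁ , v₁) , p₁) ((u₂ , v₂) , p₂) →
                        linkColour p p₁ l₁ ≢ linkColour p p₂ l₂
    linkColour-proper p p₁ p₂ (clique v≢w₁) (clique v≢w₂) a₁≢a₂ eq =
      a₁≢a₂ (arc-≡ refl (cliqueColour-injective _ _ _ _ p p₁ p₂ v≢w₁ v≢w₂ eq))
    linkColour-proper p p₁ p₂ (clique v≢w) matching _ = cliqueColour≢matchingColour _ _ _ p p₁ v≢w
    linkColour-proper p p₁ p₂ matching (clique v≢w) _ eq = cliqueColour≢matchingColour _ _ _ p p₂ v≢w (sym eq)
    linkColour-proper p p₁ p₂ matching matching a₁≢a₂ _ = a₁≢a₂ (arc-≡ refl refl)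

  sumColouring : ∀ {k} → EdgeColouring X k → ConstituentColouring k
  sumColouring C = record
    { matchingColour = λ u v p → c u v p ⊕ c u v p
    ; matchingColour-sym = λ u v p q → cong (λ x → x ⊕ x) (EdgeColouring.colour-sym C u v p q)
    ; cliqueColour = λ u v w p q → c u v p ⊕ c u w q
    ; cliqueColour-sym = λ u v w p q → ⊕-comm (c u v p) (c u w q)
    ; cliqueColour-injective = λ u v w w' p q q' _ _ eq → colour-injective C q q' (⊕-cancelˡ (c u v p) eq)
    ; cliqueColour≢matchingColour = λ u v w p q v≢w eq → v≢w (colour-injective C p q (sym (⊕-cancelˡ (c u v p) eq)))
    }
    where c = EdgeColouring.colour C

  oneFactorisationColouring : ∀ {m} → Finite X → MaxValency X (suc (suc (m * 2))) →
                              ConstituentColouring (suc (suc (m * 2)))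
  oneFactorisationColouring {m} fin mv = record
    { matchingColour = λ _ _ _ → zero
    ; matchingColour-sym = λ _ _ _ _ → refl
    ; cliqueColour = λ u v w p q → oneFactorisation (label u v p) (label u w q)
    ; cliqueColour-sym = λ u v w p q → oneFactorisation-sym (label u v p) (label u w q)
    ; cliqueColour-injective = λ u v w w' p q q' v≢w v≢w' eq →
        label-injective q q' (oneFactorisation-injective m (label-≢ p q v≢w) (label-≢ p q' v≢w') eq)
    ; cliqueColour≢matchingColour = λ u v w p q v≢w → oneFactorisation≢zero (label-≢ p q v≢w)
    }
    where
    label : ∀ u w → Adj X u w → Fin (suc (suc (m * 2)))
    label u w q = Injection.to (neighbourLabelling {X} fin mv u) (w , q)
    label-injective : ∀ {u w w'} q q' → label u w q ≡ label u w' q' → w ≡ w'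
    label-injective {u} q q' eq = cong proj₁ (Injection.injective (neighbourLabelling {X} fin mv u) eq)
    label-≢ : ∀ {u v w} p q → v ≢ w → label u v p ≢ label u w q
    label-≢ p q v≢w eq = v≢w (label-injective p q eq)

  truncation-classI : ∀ {Δ} → NoIsolatedVertices X → MaxValency X Δ → ConstituentColouring Δ → ClassI TX
  truncation-classI noIsolated mv C = classI (truncation-maxValency noIsolated mv) (truncationColouring C)

theorem7p1 : (X : Graph) → Finite X → NoIsolatedVertices X →
    (ClassI X → ClassI (CompleteGeneralizedTruncation X)) ×
    (ClassII X → (Δ : ℕ) → MaxValency X Δ → 2 ∣ Δ →
      ClassI (CompleteGeneralizedTruncation X))
theorem7p1 X fin noIsolated = classI⇒classI , evenΔ⇒classI
  where
  classI⇒classI : ClassI X → ClassI (CompleteGeneralizedTruncation X)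
  classI⇒classI (_ , mv , C , _) = truncation-classI X noIsolated mv (sumColouring X C)

  evenΔ⇒classI : ClassII X → (Δ : ℕ) → MaxValency X Δ → 2 ∣ Δ → ClassI (CompleteGeneralizedTruncation X)
  evenΔ⇒classI _ _ mv (divides zero refl) =
    truncation-classI X noIsolated mv (sumColouring X (noVertices-colouring (maxValency0⇒noVertices {X} noIsolated mv)))
  evenΔ⇒classI _ _ mv (divides (suc m) refl) =
    truncation-classI X noIsolated mv (oneFactorisationColouring X {m} fin mv)
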